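{- Let $I$ and $J$ be two independent sets in a graph $G$. If every connected component of $G[I\Delta J]$ is a path of odd length, and $|I\setminus J|=p$, then there exists a TS-sequence from $I$ to $J$ of length $p$.
   Context: A TS-sequence of length $m$ is a sequence $I_0,\ldots,I_m$ of independent sets such that each $I_{i+1}$ arises from $I_i$ by a move $u\to v$: $uv\in E(G)$, $I_i\setminus I_{i+1}=\{u\}$, $I_{i+1}\setminus I_i=\{v\}$. The length of a path is its number of edges. -}

module Defs where

open import Data.Nat using (ℕ; zero; suc; _*_; _∸_)
open import Data.Fin using (Fin)
open import Data.Fin.Subset using (Subset; _∈_; _∉_; _─_; _∪_; ⁅_⁆; ∣_∣)
open import Data.List using (List; []; _∷_; length)
open import Data.List.Relation.Unary.Unique.Propositional using (Unique)
import Data.List.Membership.Propositional as LM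
open import Data.Product using (Σ; ∃; ∃-syntax; _×_; _,_)
open import Data.Sum using (_⊎_)
open import Data.Empty using (⊥)
open import Relation.Nullary using (¬_)
open import Relation.Binary.PropositionalEquality using (_≡_)
open import Relation.Binary.Construct.Closure.ReflexiveTransitive using (Star)
open import Function.Bundles using (_⇔_)

record Graph (n : ℕ) : Set₁ where
  field
    E     : Fin n → Fin n → Set
    sym   : ∀ {u v} → E u v → E v u
    irrefl : ∀ {u} → ¬ E u u
open Graph public

module _ {n : ℕ} (G : Graph n) where

  Independent : Subset n → Set
  Independent I = ∀ u v → u ∈ I → v ∈ I → ¬ E G u v

  _Δ_ : Subset n → Subset n → Subset n
  I Δ J = (I ─ J) ∪ (J ─ I)

  EdgeIn : Subset n → Fin n → Fin n → Set
  EdgeIn S u v = u ∈ S × v ∈ S × E G u v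

  Reach : Subset n → Fin n → Fin n → Set
  Reach S = Star (EdgeIn S)

  data Consec : List (Fin n) → Fin n → Fin n → Set where
    here  : ∀ {x y vs} → Consec (x ∷ y ∷ vs) x y
    there : ∀ {z x y vs} → Consec vs x y → Consec (z ∷ vs) x y

  Odd : ℕ → Set
  Odd m = ∃[ k ] m ≡ suc (2 * k)

  -- the connected component of u in G[S] (u ∈ S) induces a path of odd length:
  -- there is a list of distinct vertices v₀,…,v_k whose set is exactly the
  -- component, such that two of them are adjacent in G iff consecutive,
  -- and the number of edges k = length − 1 is odd.
  ComponentIsOddPath : Subset n → Fin n → Set
  ComponentIsOddPath S u =
    Σ (List (Fin n)) λ vs →
      Unique vs
      × (∀ v → (v LM.∈ vs) ⇔ Reach S u v)
      × (∀ x y → x LM.∈ vs → y LM.∈ vs → (E G x y ⇔ (Consec vs x y ⊎ Consec vs y x)))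
      × Odd (length vs ∸ 1)

  AllComponentsOddPaths : Subset n → Set
  AllComponentsOddPaths S = ∀ u → u ∈ S → ComponentIsOddPath S u

  Move : Subset n → Subset n → Set
  Move I I' = ∃[ u ] ∃[ v ] (E G u v × (I ─ I') ≡ ⁅ u ⁆ × (I' ─ I) ≡ ⁅ v ⁆)

  data TSSeq : Subset n → Subset n → ℕ → Set where
    done : ∀ {I} → Independent I → TSSeq I I 0
    step : ∀ {I I' J m} → Independent I → Move I I' → TSSeq I' J m → TSSeq I J (suc m)

-- Induction on p.  If I ≠ J, pick a vertex of I ∖ J; its component in G[I Δ J] is a
-- path of odd length, hence has an even number of vertices, and since I and J are
-- independent these alternate between I ∖ J and J ∖ I.  So one end b of the path lies
-- in J ∖ I, and its neighbour a on the path is its only neighbour in I.  Sliding the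
-- token from a to b gives an independent set I' with |I' ∖ J| = p - 1, and
-- G[I' Δ J] is G[I Δ J] with the edge ab cut off the end of that path, so all its
-- components are still paths of odd length.
module Submission where

open import Defs
open import Data.Nat using (ℕ; zero; suc; _+_; _∸_)
open import Data.Nat.Properties using (suc-injective; +-suc; 0≢1+n)
open import Data.Fin using (Fin) renaming (_≟_ to _≟ᶠ_)
open import Data.Fin.Subset using (Subset; Empty; inside; outside; _∈_; _∉_; _─_; _-_; _∪_; ⁅_⁆; ∣_∣; _⊆_)
open import Data.Fin.Subset.Properties
  using (_∈?_; nonempty?; Empty-unique; ∣⊥∣≡0; p─⊥≡p; p─q⊆p; x∈p∧x∉q⇒x∈p─q; x∈p∧x≢y⇒x∈p-y;
         x∈p∪q⁻; x∈p∪q⁺; x∈⁅x⁆; x∈⁅y⁆⇒x≡y; x∉⁅y⁆⇒x≢y; ⊆-antisym)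
import Data.Vec.Base as Vec
open import Data.List using (List; []; _∷_; _++_; length; reverse; _∷ʳ_)
open import Data.List.Properties using (reverse-++; unfold-reverse; reverse-involutive; length-reverse; ++-assoc)
open import Data.List.Relation.Unary.Any using (here; there)
open import Data.List.Relation.Unary.Any.Properties using (reverse⁺; reverse⁻)
open import Data.List.Relation.Unary.Unique.Propositional using (Unique)
open import Data.List.Relation.Unary.Unique.Propositional.Properties using (drop⁺; Unique[x∷xs]⇒x∉xs)
open import Data.List.Relation.Binary.Permutation.Propositional using (↭-sym; ↭⇒↭ₛ)
open import Data.List.Relation.Binary.Permutation.Propositional.Properties using (↭-reverse)
import Data.List.Relation.Binary.Permutation.Setoid.Properties as Permutationₛ
open import Data.List.Membership.Propositional using () renaming (_∈_ to _∈ₗ_; _∉_ to _∉ₗ_)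
open import Data.Product using (∃-syntax; _×_; _,_; proj₁; proj₂)
open import Data.Sum using (_⊎_; inj₁; inj₂; swap) renaming (map to ⊎-map)
open import Data.Empty using (⊥-elim)
open import Relation.Nullary using (¬_; yes; no)
open import Relation.Binary.PropositionalEquality
  using (_≡_; _≢_; refl; trans; cong; subst; setoid; module ≡-Reasoning) renaming (sym to ≡-sym)
open import Relation.Binary.Construct.Closure.ReflexiveTransitive using (ε; _◅_; _◅◅_)
  renaming (reverse to Star-reverse)
open import Function using (_∘_)
open import Function.Bundles using (_⇔_; mk⇔; module Equivalence)
open import Function.Properties.Equivalence using () renaming (trans to ⇔-trans)
open Equivalence using (to; from)

private
  variable
    n : ℕ
    x y z u v a b : Fin n
    p q K S S′ : Subset n

x∈p─q⇒x∉q : x ∈ p ─ q → x ∉ q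
x∈p─q⇒x∉q {p = _ Vec.∷ _} {q = _ Vec.∷ _} (Vec.there x∈p─q) (Vec.there x∈q) = x∈p─q⇒x∉q x∈p─q x∈q

x∈p-y⇒x≢y : x ∈ p - y → x ≢ y
x∈p-y⇒x≢y = x∉⁅y⁆⇒x≢y ∘ x∈p─q⇒x∉q

x∈p⇒⁅x⁆⊆p : x ∈ p → ⁅ x ⁆ ⊆ p
x∈p⇒⁅x⁆⊆p {x = x} x∈p y∈⁅x⁆ with x∈⁅y⁆⇒x≡y x y∈⁅x⁆
... | refl = x∈p

x∈p-y-z⁻ : x ∈ p - y - z → x ∈ p × x ≢ y × x ≢ z
x∈p-y-z⁻ {p = p} {y = y} {z = z} x∈ =
  p─q⊆p p ⁅ y ⁆ (p─q⊆p (p - y) ⁅ z ⁆ x∈) , x∈p-y⇒x≢y (p─q⊆p (p - y) ⁅ z ⁆ x∈) , x∈p-y⇒x≢y x∈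

x∈p-y-z⁺ : x ∈ p → x ≢ y → x ≢ z → x ∈ p - y - z
x∈p-y-z⁺ x∈p x≢y x≢z = x∈p∧x≢y⇒x∈p-y (x∈p∧x≢y⇒x∈p-y x∈p x≢y) x≢z

x∈p⇒suc∣p-x∣≡∣p∣ : x ∈ p → suc ∣ p - x ∣ ≡ ∣ p ∣
x∈p⇒suc∣p-x∣≡∣p∣ {p = inside  Vec.∷ p} Vec.here        = cong (suc ∘ ∣_∣) (p─⊥≡p p)
x∈p⇒suc∣p-x∣≡∣p∣ {p = inside  Vec.∷ _} (Vec.there x∈p) = cong suc (x∈p⇒suc∣p-x∣≡∣p∣ x∈p)
x∈p⇒suc∣p-x∣≡∣p∣ {p = outside Vec.∷ _} (Vec.there x∈p) = x∈p⇒suc∣p-x∣≡∣p∣ x∈p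

slide : Subset n → Fin n → Fin n → Subset n
slide K a b = (K - a) ∪ ⁅ b ⁆

∈-slide⁻ : v ∈ slide K a b → (v ∈ K × v ≢ a) ⊎ v ≡ b
∈-slide⁻ {K = K} {a = a} {b = b} v∈ with x∈p∪q⁻ (K - a) ⁅ b ⁆ v∈
... | inj₁ v∈K-a = inj₁ (p─q⊆p K ⁅ a ⁆ v∈K-a , x∈p-y⇒x≢y v∈K-a)
... | inj₂ v∈⁅b⁆ = inj₂ (x∈⁅y⁆⇒x≡y b v∈⁅b⁆)

∈-slide⁺ : v ∈ K → v ≢ a → v ∈ slide K a b
∈-slide⁺ {K = K} {a = a} {b = b} v∈K v≢a = x∈p∪q⁺ {p = K - a} {q = ⁅ b ⁆} (inj₁ (x∈p∧x≢y⇒x∈p-y v∈K v≢a))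

target∈slide : b ∈ slide K a b
target∈slide {b = b} {K = K} {a = a} = x∈p∪q⁺ {p = K - a} {q = ⁅ b ⁆} (inj₂ (x∈⁅x⁆ b))

slide-─ : b ∈ q → slide K a b ─ q ≡ (K ─ q) - a
slide-─ {b = b} {q = q} {K = K} {a = a} b∈q = ⊆-antisym forth back
  where
  forth : slide K a b ─ q ⊆ (K ─ q) - a
  forth {v} v∈ with ∈-slide⁻ (p─q⊆p (slide K a b) q v∈)
  ... | inj₁ (v∈K , v≢a) = x∈p∧x≢y⇒x∈p-y (x∈p∧x∉q⇒x∈p─q v∈K (x∈p─q⇒x∉q v∈)) v≢a
  ... | inj₂ refl        = ⊥-elim (x∈p─q⇒x∉q v∈ b∈q)
  back : (K ─ q) - a ⊆ slide K a b ─ q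
  back v∈ = x∈p∧x∉q⇒x∈p─q (∈-slide⁺ (p─q⊆p K q (p─q⊆p (K ─ q) ⁅ a ⁆ v∈)) (x∈p-y⇒x≢y v∈))
                        (x∈p─q⇒x∉q (p─q⊆p (K ─ q) ⁅ a ⁆ v∈))

module _ {A : Set} where

  Unique-reverse : ∀ {xs : List A} → Unique xs → Unique (reverse xs)
  Unique-reverse {xs} = Permutationₛ.Unique-resp-↭ (setoid A) (↭⇒↭ₛ (↭-sym (↭-reverse xs)))

  lastOf : A → List A → A
  lastOf c []       = c
  lastOf c (d ∷ ds) = lastOf d ds

  reverse-∷ : ∀ c xs → ∃[ r ] reverse (c ∷ xs) ≡ lastOf c xs ∷ r
  reverse-∷ c []       = [] , refl
  reverse-∷ c (d ∷ ds) with reverse-∷ d ds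
  ... | r , eq = r ∷ʳ c , trans (unfold-reverse c (d ∷ ds)) (cong (_∷ʳ c) eq)

Odd-pred₂ : ∀ {m} (G : Graph n) → Odd G (suc (suc m)) → Odd G m
Odd-pred₂ G (zero  , ())
Odd-pred₂ G (suc k , eq) = k , trans (suc-injective (suc-injective eq)) (+-suc k (k + 0))

module _ (G : Graph n) where

  open import Data.List.Membership.DecPropositional (_≟ᶠ_ {n}) using () renaming (_∈?_ to _∈ₗ?_)

  Adjacent : List (Fin n) → Fin n → Fin n → Set
  Adjacent vs x y = Consec G vs x y ⊎ Consec G vs y x

  consec⇒∈ : ∀ {vs} → Consec G vs x y → x ∈ₗ vs × y ∈ₗ vs
  consec⇒∈ here      = here refl , there (here refl)
  consec⇒∈ (there c) with consec⇒∈ c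
  ... | x∈ , y∈ = there x∈ , there y∈

  consec-∷⇒∈ʳ : ∀ {w ws} → Consec G (w ∷ ws) x y → y ∈ₗ ws
  consec-∷⇒∈ʳ here      = here refl
  consec-∷⇒∈ʳ (there c) = proj₂ (consec⇒∈ c)

  consec-∷⁻ : ∀ {w ws} → x ≢ w → Consec G (w ∷ ws) x y → Consec G ws x y
  consec-∷⁻ x≢w here      = ⊥-elim (x≢w refl)
  consec-∷⁻ x≢w (there c) = c

  consec-head : ∀ {w ws} → x ∉ₗ w ∷ ws → Consec G (x ∷ w ∷ ws) x y → y ≡ w
  consec-head x∉ here      = refl
  consec-head x∉ (there c) = ⊥-elim (x∉ (proj₁ (consec⇒∈ c)))

  consec-split : ∀ {vs} → Consec G vs x y → ∃[ ps ] ∃[ qs ] vs ≡ ps ++ x ∷ y ∷ qs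
  consec-split (here {vs = vs}) = [] , vs , refl
  consec-split (there {z = w} c) with consec-split c
  ... | ps , qs , eq = w ∷ ps , qs , cong (w ∷_) eq

  consec-++ : ∀ ps {qs} → Consec G (ps ++ x ∷ y ∷ qs) x y
  consec-++ []       = here
  consec-++ (_ ∷ ps) = there (consec-++ ps)

  consec-reverse : ∀ {vs} → Consec G vs x y → Consec G (reverse vs) y x
  consec-reverse {x = x} {y = y} c with consec-split c
  ... | ps , qs , refl = subst (λ ws → Consec G ws y x) (≡-sym reverse-split) (consec-++ (reverse qs))
    where
    open ≡-Reasoning
    reverse-split : reverse (ps ++ x ∷ y ∷ qs) ≡ reverse qs ++ y ∷ x ∷ reverse ps
    reverse-split = begin
      reverse (ps ++ x ∷ y ∷ qs)               ≡⟨ reverse-++ ps (x ∷ y ∷ qs) ⟩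
      reverse (x ∷ y ∷ qs) ++ reverse ps       ≡⟨ cong (_++ reverse ps) (reverse-++ (x ∷ y ∷ []) qs) ⟩
      (reverse qs ++ y ∷ x ∷ []) ++ reverse ps ≡⟨ ++-assoc (reverse qs) (y ∷ x ∷ []) (reverse ps) ⟩
      reverse qs ++ y ∷ x ∷ reverse ps         ∎

  consec-reverse⁻ : ∀ {vs} → Consec G (reverse vs) x y → Consec G vs y x
  consec-reverse⁻ {vs = vs} c = subst (λ ws → Consec G ws _ _) (reverse-involutive vs) (consec-reverse c)

  Adjacent-reverse : ∀ {vs} → Adjacent vs x y ⇔ Adjacent (reverse vs) x y
  Adjacent-reverse = mk⇔ (swap ∘ ⊎-map consec-reverse consec-reverse)
                         (swap ∘ ⊎-map consec-reverse⁻ consec-reverse⁻)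

  Reach-sym : Reach G S x y → Reach G S y x
  Reach-sym = Star-reverse λ { (x∈ , y∈ , e) → y∈ , x∈ , sym G e }

  Reach-closed : x ∈ S → Reach G S x y → y ∈ S
  Reach-closed x∈ ε                  = x∈
  Reach-closed _  ((_ , w∈ , _) ◅ r) = Reach-closed w∈ r

  Reach-mono : S ⊆ S′ → Reach G S x y → Reach G S′ x y
  Reach-mono S⊆S′ ε                   = ε
  Reach-mono S⊆S′ ((x∈ , w∈ , e) ◅ r) = (S⊆S′ x∈ , S⊆S′ w∈ , e) ◅ Reach-mono S⊆S′ r

  Reach-restrict : (∀ {w} → Reach G S x w → w ∈ S′) → Reach G S x y → Reach G S′ x y
  Reach-restrict inS′ ε                 = ε
  Reach-restrict inS′ (e@(_ , _ , xw) ◅ r) =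
    (inS′ ε , inS′ (e ◅ ε) , xw) ◅ Reach-restrict (λ r′ → inS′ (e ◅ r′)) r

  Reach-edge : x ∈ S → y ∈ S → E G x y → Reach G S x y
  Reach-edge x∈ y∈ e = (x∈ , y∈ , e) ◅ ε

  Reach-along : ∀ {vs} → (∀ {v} → v ∈ₗ vs → v ∈ S) → (∀ {v w} → Consec G vs v w → E G v w)
              → x ∈ₗ vs → y ∈ₗ vs → Reach G S x y
  Reach-along {vs = c ∷ cs} inS edges x∈ y∈ = Reach-sym (from-head inS edges x∈) ◅◅ from-head inS edges y∈
    where
    from-head : ∀ {c cs} → (∀ {v} → v ∈ₗ c ∷ cs → v ∈ S) → (∀ {v w} → Consec G (c ∷ cs) v w → E G v w)
              → y ∈ₗ c ∷ cs → Reach G S c y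
    from-head inS edges (here refl) = ε
    from-head {cs = d ∷ ds} inS edges (there y∈) =
      Reach-edge (inS (here refl)) (inS (there (here refl))) (edges here)
      ◅◅ from-head (inS ∘ there) (edges ∘ there) y∈

  -- The body of ComponentIsOddPath, which is thus Σ vs (IsOddPathComponent S u vs) by definition.
  IsOddPathComponent : Subset n → Fin n → List (Fin n) → Set
  IsOddPathComponent S u vs =
    Unique vs
    × (∀ v → (v ∈ₗ vs) ⇔ Reach G S u v)
    × (∀ x y → x ∈ₗ vs → y ∈ₗ vs → (E G x y ⇔ Adjacent vs x y))
    × Odd G (length vs ∸ 1)

  component⊆ : ∀ {vs} → u ∈ S → IsOddPathComponent S u vs → v ∈ₗ vs → v ∈ S
  component⊆ u∈S (_ , members , _) v∈ = Reach-closed u∈S (to (members _) v∈)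

  component-consec⇒E : ∀ {vs} → IsOddPathComponent S u vs → Consec G vs x y → E G x y
  component-consec⇒E (_ , _ , adjacency , _) c with consec⇒∈ c
  ... | x∈ , y∈ = from (adjacency _ _ x∈ y∈) (inj₁ c)

  component-reverse : ∀ {vs} → IsOddPathComponent S u vs → IsOddPathComponent S u (reverse vs)
  component-reverse {vs = vs} (uniq , members , adjacency , k , odd) =
    Unique-reverse uniq ,
    (λ v → mk⇔ (to (members v) ∘ reverse⁻) (reverse⁺ ∘ from (members v))) ,
    (λ x y x∈ y∈ → ⇔-trans (adjacency x y (reverse⁻ x∈) (reverse⁻ y∈)) Adjacent-reverse) ,
    k , trans (cong (_∸ 1) (length-reverse vs)) odd

  component-restrict : ∀ {vs} → S′ ⊆ S → (∀ {w} → Reach G S u w → w ∈ S′)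
                     → IsOddPathComponent S u vs → IsOddPathComponent S′ u vs
  component-restrict S′⊆S inS′ (uniq , members , adjacency , odd) =
    uniq , (λ v → mk⇔ (Reach-restrict inS′ ∘ to (members v)) (from (members v) ∘ Reach-mono S′⊆S)) , adjacency , odd

  endpoint-neighbour : ∀ {vs} → u ∈ S → IsOddPathComponent S u (b ∷ a ∷ vs) → v ∈ S → E G b v → v ≡ a
  endpoint-neighbour {b = b} {a = a} {v = v} {vs = vs} u∈S comp@(uniq , members , adjacency , _) v∈S e =
    neighbour (to (adjacency _ _ (here refl) v∈path) e)
    where
    v∈path : v ∈ₗ b ∷ a ∷ vs
    v∈path = from (members v) (to (members b) (here refl) ◅◅ Reach-edge (component⊆ u∈S comp (here refl)) v∈S e)
    neighbour : Adjacent (b ∷ a ∷ vs) b v → v ≡ a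
    neighbour (inj₁ c) = consec-head (Unique[x∷xs]⇒x∉xs uniq) c
    neighbour (inj₂ c) = ⊥-elim (Unique[x∷xs]⇒x∉xs uniq (consec-∷⇒∈ʳ c))

  component-drop₂ : ∀ {vs} → x ∈ S → IsOddPathComponent S x (b ∷ a ∷ vs) → u ∈ₗ vs
                  → IsOddPathComponent (S - b - a) u vs
  component-drop₂ {S = S} {b = b} {a = a} {u = u} {vs = vs} x∈S comp@(uniq , members , adjacency , odd) u∈vs =
    drop⁺ 2 uniq , members′ , adjacency′ , Odd-drop₂ u∈vs odd
    where
    ≢b : ∀ {w} → w ∈ₗ vs → w ≢ b
    ≢b w∈ refl = Unique[x∷xs]⇒x∉xs uniq (there w∈)
    ≢a : ∀ {w} → w ∈ₗ vs → w ≢ a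
    ≢a w∈ refl = Unique[x∷xs]⇒x∉xs (drop⁺ 1 uniq) w∈
    inS′ : ∀ {w} → w ∈ₗ vs → w ∈ S - b - a
    inS′ w∈ = x∈p-y-z⁺ (component⊆ x∈S comp (there (there w∈))) (≢b w∈) (≢a w∈)
    strip : ∀ {w w′} → w ∈ₗ vs → Consec G (b ∷ a ∷ vs) w w′ → Consec G vs w w′
    strip w∈ = consec-∷⁻ (≢a w∈) ∘ consec-∷⁻ (≢b w∈)
    Odd-drop₂ : ∀ {ws} → u ∈ₗ ws → Odd G (length (b ∷ a ∷ ws) ∸ 1) → Odd G (length ws ∸ 1)
    Odd-drop₂ {ws = _ ∷ _} _ = Odd-pred₂ G
    members′ : ∀ v → (v ∈ₗ vs) ⇔ Reach G (S - b - a) u v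
    members′ v = mk⇔ (Reach-along inS′ (λ c → component-consec⇒E comp (there (there c))) u∈vs) back
      where
      back : Reach G (S - b - a) u v → v ∈ₗ vs
      back r with x∈p-y-z⁻ (Reach-closed (inS′ u∈vs) r)
                | from (members v) (to (members u) (there (there u∈vs)) ◅◅ Reach-mono (proj₁ ∘ x∈p-y-z⁻) r)
      ... | _ , v≢b , _ | here v≡b         = ⊥-elim (v≢b v≡b)
      ... | _ , _ , v≢a | there (here v≡a) = ⊥-elim (v≢a v≡a)
      ... | _           | there (there v∈) = v∈

    adjacency′ : ∀ y z → y ∈ₗ vs → z ∈ₗ vs → (E G y z ⇔ Adjacent vs y z)
    adjacency′ y z y∈ z∈ = mk⇔ (⊎-map (strip y∈) (strip z∈) ∘ to adjacency-yz)
                               (from adjacency-yz ∘ ⊎-map (λ c → there (there c)) (λ c → there (there c)))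
      where
      adjacency-yz : E G y z ⇔ Adjacent (b ∷ a ∷ vs) y z
      adjacency-yz = adjacency y z (there (there y∈)) (there (there z∈))

  AllComponentsOddPaths-drop₂ : ∀ {vs} → x ∈ S → AllComponentsOddPaths G S
                              → IsOddPathComponent S x (b ∷ a ∷ vs) → AllComponentsOddPaths G (S - b - a)
  AllComponentsOddPaths-drop₂ {x = x} {S = S} {b = b} {a = a} {vs = vs} x∈S components comp@(_ , members , _) u u∈
    with u ∈ₗ? vs
  ... | yes u∈vs = vs , component-drop₂ x∈S comp u∈vs
  ... | no  u∉vs with components u (proj₁ (x∈p-y-z⁻ u∈))
  ...   | ws , comp-u = ws , component-restrict (proj₁ ∘ x∈p-y-z⁻) avoids-ab comp-u
    where
    unreachable : ¬ Reach G S x u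
    unreachable r with from (members u) r | x∈p-y-z⁻ u∈
    ... | here u≡b           | _ , u≢b , _ = u≢b u≡b
    ... | there (here u≡a)   | _ , _ , u≢a = u≢a u≡a
    ... | there (there u∈vs) | _           = u∉vs u∈vs
    avoids-ab : ∀ {w} → Reach G S u w → w ∈ S - b - a
    avoids-ab r = x∈p-y-z⁺ (Reach-closed (proj₁ (x∈p-y-z⁻ u∈)) r)
      (λ { refl → unreachable (to (members b) (here refl) ◅◅ Reach-sym r) })
      (λ { refl → unreachable (to (members a) (there (here refl)) ◅◅ Reach-sym r) })

  slide-move : E G a b → a ∈ K → b ∉ K → Move G K (slide K a b)
  slide-move {a = a} {b = b} {K = K} e a∈K b∉K =
    a , b , e , ⊆-antisym leaving (x∈p⇒⁅x⁆⊆p (x∈p∧x∉q⇒x∈p─q a∈K a∉slide))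
              , ⊆-antisym entering (x∈p⇒⁅x⁆⊆p (x∈p∧x∉q⇒x∈p─q target∈slide b∉K))
    where
    a∉slide : a ∉ slide K a b
    a∉slide a∈ with ∈-slide⁻ a∈
    ... | inj₁ (_ , a≢a) = a≢a refl
    ... | inj₂ refl      = b∉K a∈K
    leaving : K ─ slide K a b ⊆ ⁅ a ⁆
    leaving {v} v∈ with v ≟ᶠ a
    ... | yes refl = x∈⁅x⁆ a
    ... | no  v≢a  = ⊥-elim (x∈p─q⇒x∉q v∈ (∈-slide⁺ (p─q⊆p K _ v∈) v≢a))
    entering : slide K a b ─ K ⊆ ⁅ b ⁆
    entering v∈ with ∈-slide⁻ (p─q⊆p _ K v∈)
    ... | inj₁ (v∈K , _) = ⊥-elim (x∈p─q⇒x∉q v∈ v∈K)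
    ... | inj₂ refl      = x∈⁅x⁆ b

  slide-independent : Independent G K → (∀ v → v ∈ K → E G b v → v ≡ a) → Independent G (slide K a b)
  slide-independent indK only-a u v u∈ v∈ e with ∈-slide⁻ u∈ | ∈-slide⁻ v∈
  ... | inj₁ (u∈K , _)   | inj₁ (v∈K , _)   = indK u v u∈K v∈K e
  ... | inj₂ refl        | inj₂ refl        = irrefl G e
  ... | inj₂ refl        | inj₁ (v∈K , v≢a) = v≢a (only-a v v∈K e)
  ... | inj₁ (u∈K , u≢a) | inj₂ refl        = u≢a (only-a u u∈K (sym G e))

  odd-alternating-last : ∀ {P : Fin n → Set} c xs
                       → (∀ {y z} → Consec G (c ∷ xs) y z → (P y → ¬ P z) × (¬ P y → P z))
                       → Odd G (length xs) → P c → ¬ P (lastOf c xs)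
  odd-alternating-last c []           alternates (_ , ()) Pc
  odd-alternating-last c (d ∷ [])     alternates odd Pc = proj₁ (alternates here) Pc
  odd-alternating-last c (d ∷ e ∷ zs) alternates odd Pc =
    odd-alternating-last e zs (λ c′ → alternates (there (there c′))) (Odd-pred₂ G odd)
      (proj₂ (alternates (there here)) (proj₁ (alternates here) Pc))

module _ (G : Graph n) (J : Subset n) (J-independent : Independent G J) where

  Δ[_] : Subset n → Subset n
  Δ[ K ] = _Δ_ G K J

  ∈Δ⁻ : v ∈ Δ[ K ] → (v ∈ K × v ∉ J) ⊎ (v ∈ J × v ∉ K)
  ∈Δ⁻ {K = K} v∈ = ⊎-map (λ v∈ → p─q⊆p K J v∈ , x∈p─q⇒x∉q v∈) (λ v∈ → p─q⊆p J K v∈ , x∈p─q⇒x∉q v∈)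
                         (x∈p∪q⁻ (K ─ J) (J ─ K) v∈)

  ∈Δ⁺ˡ : v ∈ K → v ∉ J → v ∈ Δ[ K ]
  ∈Δ⁺ˡ {K = K} v∈K v∉J = x∈p∪q⁺ {p = K ─ J} {q = J ─ K} (inj₁ (x∈p∧x∉q⇒x∈p─q v∈K v∉J))

  ∈Δ⁺ʳ : v ∈ J → v ∉ K → v ∈ Δ[ K ]
  ∈Δ⁺ʳ {K = K} v∈J v∉K = x∈p∪q⁺ {p = K ─ J} {q = J ─ K} (inj₂ (x∈p∧x∉q⇒x∈p─q v∈J v∉K))

  ∈Δ∧∈⇒∉ : v ∈ Δ[ K ] → v ∈ K → v ∉ J
  ∈Δ∧∈⇒∉ v∈ v∈K with ∈Δ⁻ v∈
  ... | inj₁ (_ , v∉J) = v∉J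
  ... | inj₂ (_ , v∉K) = ⊥-elim (v∉K v∈K)

  ∈Δ∧∉⇒∈ : v ∈ Δ[ K ] → v ∉ K → v ∈ J
  ∈Δ∧∉⇒∈ v∈ v∉K with ∈Δ⁻ v∈
  ... | inj₁ (v∈K , _) = ⊥-elim (v∉K v∈K)
  ... | inj₂ (v∈J , _) = v∈J

  Δ-empty⇒≡ : Empty Δ[ K ] → K ≡ J
  Δ-empty⇒≡ {K = K} empty = ⊆-antisym K⊆J J⊆K
    where
    K⊆J : K ⊆ J
    K⊆J {v} v∈K with v ∈? J
    ... | yes v∈J = v∈J
    ... | no  v∉J = ⊥-elim (empty (v , ∈Δ⁺ˡ v∈K v∉J))
    J⊆K : J ⊆ K
    J⊆K {v} v∈J with v ∈? K
    ... | yes v∈K = v∈K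
    ... | no  v∉K = ⊥-elim (empty (v , ∈Δ⁺ʳ v∈J v∉K))

  slide-Δ : a ∈ K → a ∉ J → b ∈ J → b ∉ K → Δ[ slide K a b ] ≡ Δ[ K ] - b - a
  slide-Δ {a = a} {K = K} {b = b} a∈K a∉J b∈J b∉K = ⊆-antisym forth back
    where
    forth : Δ[ slide K a b ] ⊆ Δ[ K ] - b - a
    forth v∈ with ∈Δ⁻ v∈
    ... | inj₁ (v∈K′ , v∉J) with ∈-slide⁻ v∈K′
    ...   | inj₁ (v∈K , v≢a) = x∈p-y-z⁺ (∈Δ⁺ˡ v∈K v∉J) (λ { refl → b∉K v∈K }) v≢a
    ...   | inj₂ refl        = ⊥-elim (v∉J b∈J)
    forth v∈ | inj₂ (v∈J , v∉K′) =
      x∈p-y-z⁺ (∈Δ⁺ʳ v∈J (λ v∈K → v∉K′ (∈-slide⁺ v∈K v≢a))) (λ { refl → v∉K′ target∈slide }) v≢a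
      where
      v≢a : _ ≢ a
      v≢a refl = a∉J v∈J
    back : Δ[ K ] - b - a ⊆ Δ[ slide K a b ]
    back v∈ with x∈p-y-z⁻ v∈
    ... | v∈Δ , v≢b , v≢a with ∈Δ⁻ v∈Δ
    ...   | inj₁ (v∈K , v∉J) = ∈Δ⁺ˡ (∈-slide⁺ v∈K v≢a) v∉J
    ...   | inj₂ (v∈J , v∉K) = ∈Δ⁺ʳ v∈J v∉K′
      where
      v∉K′ : _ ∉ slide K a b
      v∉K′ v∈K′ with ∈-slide⁻ v∈K′
      ... | inj₁ (v∈K , _) = v∉K v∈K
      ... | inj₂ v≡b       = v≢b v≡b

  alternation : Independent G K → y ∈ Δ[ K ] → z ∈ Δ[ K ] → E G y z → (y ∈ K → z ∉ K) × (y ∉ K → z ∈ K)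
  alternation {K = K} {y = y} {z = z} indK y∈ z∈ e = (λ y∈K z∈K → indK y z y∈K z∈K e) , z∈K
    where
    z∈K : y ∉ K → z ∈ K
    z∈K y∉K with z ∈? K
    ... | yes z∈K = z∈K
    ... | no  z∉K = ⊥-elim (J-independent y z (∈Δ∧∉⇒∈ y∈ y∉K) (∈Δ∧∉⇒∈ z∈ z∉K) e)

  odd-path-ends : ∀ {c xs} → Independent G K → x ∈ Δ[ K ] → IsOddPathComponent G Δ[ K ] x (c ∷ xs)
                → c ∈ K → lastOf c xs ∉ K
  odd-path-ends {K = K} {c = c} {xs = xs} indK x∈ comp@(_ , _ , _ , odd) = odd-alternating-last G c xs alternates odd
    where
    alternates : ∀ {y z} → Consec G (c ∷ xs) y z → (y ∈ K → z ∉ K) × (y ∉ K → z ∈ K)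
    alternates cyz with consec⇒∈ G cyz
    ... | y∈ , z∈ = alternation indK (component⊆ G x∈ comp y∈) (component⊆ G x∈ comp z∈) (component-consec⇒E G comp cyz)

  path-from-outside : ∀ {vs} → Independent G K → x ∈ Δ[ K ] → IsOddPathComponent G Δ[ K ] x vs
                    → ∃[ b ] ∃[ a ] ∃[ ws ] IsOddPathComponent G Δ[ K ] x (b ∷ a ∷ ws) × b ∉ K
  path-from-outside {vs = []}     _ _ (_ , _ , _ , _ , ())
  path-from-outside {vs = _ ∷ []} _ _ (_ , _ , _ , _ , ())
  path-from-outside {K = K} {vs = c ∷ d ∷ rest} indK x∈ comp with c ∈? K | reverse-∷ c (d ∷ rest)
  ... | no  c∉K | _           = c , d , rest , comp , c∉K
  ... | yes c∈K | [] , eq     with trans (≡-sym (length-reverse (c ∷ d ∷ rest))) (cong length eq)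
  ...   | ()
  path-from-outside {K = K} {x = x} {vs = c ∷ d ∷ rest} indK x∈ comp | yes c∈K | a ∷ ws , eq =
    lastOf d rest , a , ws , subst (IsOddPathComponent G Δ[ K ] x) eq (component-reverse G comp) ,
    odd-path-ends indK x∈ comp c∈K

  slide-step : Independent G K → AllComponentsOddPaths G Δ[ K ] → x ∈ Δ[ K ]
             → ∃[ K′ ] Move G K K′ × Independent G K′ × AllComponentsOddPaths G Δ[ K′ ]
                       × suc ∣ K′ ─ J ∣ ≡ ∣ K ─ J ∣
  slide-step {K = K} {x = x} indK components x∈ with path-from-outside indK x∈ (proj₂ (components x x∈))
  ... | b , a , ws , comp , b∉K =
    slide K a b , slide-move G (sym G ba) a∈K b∉K , slide-independent G indK only-a ,
    subst (AllComponentsOddPaths G) (≡-sym (slide-Δ a∈K a∉J b∈J b∉K)) (AllComponentsOddPaths-drop₂ G x∈ components comp) ,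
    trans (cong (suc ∘ ∣_∣) (slide-─ {K = K} {a = a} b∈J)) (x∈p⇒suc∣p-x∣≡∣p∣ (x∈p∧x∉q⇒x∈p─q a∈K a∉J))
    where
    b∈Δ : b ∈ Δ[ K ]
    b∈Δ = component⊆ G x∈ comp (here refl)
    a∈Δ : a ∈ Δ[ K ]
    a∈Δ = component⊆ G x∈ comp (there (here refl))
    ba : E G b a
    ba = component-consec⇒E G comp here
    b∈J : b ∈ J
    b∈J = ∈Δ∧∉⇒∈ b∈Δ b∉K
    a∈K : a ∈ K
    a∈K = proj₂ (alternation indK b∈Δ a∈Δ ba) b∉K
    a∉J : a ∉ J
    a∉J = ∈Δ∧∈⇒∉ a∈Δ a∈K
    only-a : ∀ v → v ∈ K → E G b v → v ≡ a
    only-a v v∈K bv with v ∈? J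
    ... | yes v∈J = ⊥-elim (J-independent b v b∈J v∈J bv)
    ... | no  v∉J = endpoint-neighbour G x∈ comp (∈Δ⁺ˡ v∈K v∉J) bv

  reconfigure : ∀ p → Independent G K → AllComponentsOddPaths G Δ[ K ] → ∣ K ─ J ∣ ≡ p → TSSeq G K J p
  reconfigure {K = K} zero indK components count with nonempty? Δ[ K ]
  ... | no  empty = subst (λ L → TSSeq G K L 0) (Δ-empty⇒≡ empty) (done indK)
  ... | yes (x , x∈) with slide-step indK components x∈
  ...   | _ , _ , _ , _ , count′ = ⊥-elim (0≢1+n (trans (≡-sym count) (≡-sym count′)))
  reconfigure {K = K} (suc p) indK components count with nonempty? (K ─ J)
  ... | no  empty = ⊥-elim (0≢1+n (trans (≡-sym (∣⊥∣≡0 n)) (trans (cong ∣_∣ (≡-sym (Empty-unique empty))) count)))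
  ... | yes (x , x∈K─J) with slide-step indK components (x∈p∪q⁺ (inj₁ x∈K─J))
  ...   | _ , move , indK′ , components′ , count′ =
    step indK move (reconfigure p indK′ components′ (suc-injective (trans count′ count)))

proposition24 : ∀ {n : ℕ} (G : Graph n) (I J : Subset n) (p : ℕ)
    → Independent G I → Independent G J
    → AllComponentsOddPaths G (_Δ_ G I J)
    → ∣ I ─ J ∣ ≡ p
    → TSSeq G I J p
proposition24 G I J p I-independent J-independent = reconfigure G J J-independent p I-independent
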